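{- The generating function $\sum_{n\geq0} d_n x^n$, where $d_n$ is the number of $132$-avoiding Dumont permutations of length $n$, equals $(1+x)C(x^2)$. Equivalently, for every $n\geq 0$ the number of $132$-avoiding Dumont permutations in $S_n$ equals the Catalan number $C_{\lfloor n/2\rfloor}$.
   Context: A permutation $\pi=\pi_1\cdots\pi_n\in S_n$ is a Dumont permutation (of the first kind) if every even entry $\pi_i$ is followed by a smaller entry ($i<n$ and $\pi_{i+1}<\pi_i$) and every odd entry $\pi_i$ is either last ($i=n$) or followed by a larger entry ($\pi_{i+1}>\pi_i$); the empty permutation is a Dumont permutation. $\pi$ avoids $132$ if there are no $i<j<l$ with $\pi_i<\pi_l<\pi_j$. $C_m=\frac{1}{m+1}\binom{2m}{m}$ is the $m$th Catalan number and $C(x)=\sum_{m\geq0}C_mx^m=\frac{1-\sqrt{1-4x}}{2x}$. -}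

module Defs where

open import Data.Nat using (ℕ; zero; suc; _+_; _<_; _/_)
open import Data.Nat.Combinatorics using (_C_)
open import Data.Nat.Divisibility using (_∣_)
open import Data.Fin using (Fin; toℕ; _<_)
open import Data.Vec using (Vec; lookup)
open import Data.Product using (Σ; _×_; ∃; proj₁)
open import Function.Definitions using (Injective)
open import Relation.Binary.PropositionalEquality using (_≡_)
open import Relation.Nullary using (¬_)

Even : ℕ → Set
Even k = 2 ∣ k

Odd : ℕ → Set
Odd k = ¬ (2 ∣ k)

-- Entry with Fin-value v stands for the value v + 1 ∈ {1,…,n}.
IsPerm : (n : ℕ) → Vec (Fin n) n → Set
IsPerm n v = Injective _≡_ _≡_ (lookup v)

val : {n : ℕ} → Vec (Fin n) n → Fin n → ℕ
val v i = suc (toℕ (lookup v i))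

IsDumont : (n : ℕ) → Vec (Fin n) n → Set
IsDumont n v =
  ((i : Fin n) → Even (val v i) →
     ∃ λ (j : Fin n) → (toℕ j ≡ suc (toℕ i)) × (val v j Data.Nat.< val v i))
  × ((i j : Fin n) → Odd (val v i) → toℕ j ≡ suc (toℕ i) →
       val v i Data.Nat.< val v j)

Avoids132 : (n : ℕ) → Vec (Fin n) n → Set
Avoids132 n v = (i j l : Fin n) → i Data.Fin.< j → j Data.Fin.< l →
  ¬ ((val v i Data.Nat.< val v l) × (val v l Data.Nat.< val v j))

IsDumontAvoid132 : (n : ℕ) → Vec (Fin n) n → Set
IsDumontAvoid132 n v = IsPerm n v × IsDumont n v × Avoids132 n v

-- "The set {v | P v} has exactly k elements": an enumeration
-- Fin k → Vec (Fin n) n that is injective, lands in P, and hits every v with P v.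
-- (Stated this way rather than as Fin k ↔ Σ … P, because P is a
-- function type and Σ-equality would otherwise need funext.)
HasCount : {A : Set} → (A → Set) → ℕ → Set
HasCount {A} P k = Σ (Fin k → A) λ f →
  Injective _≡_ _≡_ f × ((i : Fin k) → P (f i)) × ((a : A) → P a → ∃ λ i → f i ≡ a)

catalan : ℕ → ℕ
catalan m = ((m + m) C m) / suc m

-- In a 132-avoiding permutation α n β with maximum n, every letter of α exceeds every letter of
-- β, and both avoid 132. The Dumont condition adds: n is odd iff β is empty, and if α is nonempty
-- its least letter |β| + 1 is followed by a larger letter, so |β| is even. Hence the 132-avoiding
-- Dumont permutations of length 2m + 1 are those of length 2m followed by 2m + 1, while those of
-- length 2m + 2 have either α empty and β of length 2m + 1, or α of odd length 2i + 1 and β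
-- nonempty of even length 2j with i + j = m. Both families are therefore in bijection with the
-- binary trees with m nodes (a leaf as right subtree marking α empty), whose number satisfies the
-- Segner recurrence; the closed form binom(2m, m) / (m + 1) follows from the ballot numbers and the
-- reflection principle.

module Submission where

open import Defs

open import Data.Nat using (ℕ; zero; suc; _+_; _*_; _∸_; _/_; ⌊_/2⌋; _≤_; _<_; z≤n; s≤s)
open import Data.Nat.Properties
open import Data.Nat.Induction using (<-rec)
open import Data.Nat.Divisibility using (_∣_; divides; ∣-refl; ∣m∣n⇒∣m+n; ∣m+n∣m⇒∣n; ∣1⇒≡1)
open import Data.Nat.Combinatorics using (_C_; nC1≡n; nCk≡nC[n∸k]; nCk+nC[k+1]≡[n+1]C[k+1])
open import Data.Nat.DivMod using (m*n/n≡m; +-distrib-/-∣ʳ)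
open import Data.Nat.Tactic.RingSolver using (solve-∀)
open import Data.Empty using (⊥; ⊥-elim)
open import Data.Unit using (⊤; tt)
open import Data.Vec as Vec using (Vec)
open import Data.List using (List; []; _∷_; _++_; map; length; tabulate; applyUpTo)
open import Data.List.Properties
  using ( length-map; length-++; length-++-sucʳ; length-applyUpTo; length-tabulate
        ; map-injective; map-id-local; map-∘; ∷-injective; ∷-injectiveˡ)
open import Data.List.Membership.Propositional using (_∈_; _∉_)
open import Data.List.Membership.Propositional.Properties
  using (∈-∃++; ∈-++⁻; ∈-++⁺ˡ; ∈-++⁺ʳ; ∈-map⁺; ∈-map⁻; ∈-applyUpTo⁺; ∈-applyUpTo⁻; ∈-tabulate⁺; ∈-tabulate⁻)
open import Data.List.Membership.DecPropositional _≟_ using (_∈?_)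
open import Data.List.Relation.Unary.Any using (here; there)
open import Data.List.Relation.Unary.All as All using (All; []; _∷_)
open import Data.List.Relation.Unary.All.Properties using (¬Any⇒All¬) renaming (++⁻ to All-++⁻)
open import Data.List.Relation.Unary.AllPairs as AllPairs using ([]; _∷_)
open import Data.List.Relation.Unary.Unique.Propositional using (Unique)
import Data.List.Relation.Unary.Unique.Propositional.Properties as Unique
open import Data.List.Relation.Binary.Subset.Propositional using (_⊆_)
open import Data.List.Relation.Binary.Disjoint.Propositional using (Disjoint)
open import Data.List.Relation.Binary.Sublist.Propositional
  using ([]; _∷_; _∷ʳ_; from∈; to∈; minimum) renaming (_⊆_ to _⊑_)
open import Data.List.Relation.Binary.Sublist.Propositional.Properties
  using (++⁺; ++⁺ˡ; ++⁺ʳ; ∷ˡ⁻) renaming (map⁺ to ⊑-map⁺)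
open import Data.Fin as Fin using (Fin; toℕ; fromℕ<)
open import Data.Fin.Properties using (+↔⊎; *↔×; toℕ<n; toℕ-fromℕ<; toℕ-injective)
open import Data.Product using (∃; ∃₂; _×_; _,_; proj₁; proj₂; uncurry) renaming (map to ×-map)
open import Data.Sum using (_⊎_; inj₁; inj₂; [_,_]′)
open import Function using (_∘_; id; _↔_; Inverse)
open import Function.Definitions using (Injective)
open import Relation.Nullary using (¬_; yes; no)
open import Relation.Binary.PropositionalEquality

open import Algebra.Properties.CommutativeSemigroup +-commutativeSemigroup
  using (interchange; xy∙z≈xz∙y)

-- Dyck paths and Catalan numbers

-- dyckFrom h m counts the lattice paths with m up-steps and h + m down-steps, from height h
-- down to 0, that never go below 0.
dyckFrom : ℕ → ℕ → ℕ
dyckFrom h       zero    = 1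
dyckFrom zero    (suc m) = dyckFrom 1 m
dyckFrom (suc h) (suc m) = dyckFrom h (suc m) + dyckFrom (suc (suc h)) m

dyck : ℕ → ℕ
dyck = dyckFrom 0

convolve : (ℕ → ℕ) → (ℕ → ℕ) → ℕ → ℕ
convolve f g zero    = f 0 * g 0
convolve f g (suc m) = convolve f (g ∘ suc) m + f (suc m) * g 0

convolve-+ : ∀ f g h m → convolve f (λ k → g k + h k) m ≡ convolve f g m + convolve f h m
convolve-+ f g h zero    = *-distribˡ-+ (f 0) (g 0) (h 0)
convolve-+ f g h (suc m) = begin
  convolve f (λ k → g (suc k) + h (suc k)) m + f (suc m) * (g 0 + h 0)
    ≡⟨ cong₂ _+_ (convolve-+ f (g ∘ suc) (h ∘ suc) m) (*-distribˡ-+ (f (suc m)) (g 0) (h 0)) ⟩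
  (convolve f (g ∘ suc) m + convolve f (h ∘ suc) m) + (f (suc m) * g 0 + f (suc m) * h 0)
    ≡⟨ interchange (convolve f (g ∘ suc) m) (convolve f (h ∘ suc) m) (f (suc m) * g 0) (f (suc m) * h 0) ⟩
  convolve f g (suc m) + convolve f h (suc m) ∎
  where open ≡-Reasoning

-- First-return decomposition: a path from height h + 1 first reaches height h after a Dyck path.
convolve-dyckFrom : ∀ m h → convolve dyck (dyckFrom h) m ≡ dyckFrom (suc h) m
convolve-dyckFrom zero    h       = refl
convolve-dyckFrom (suc m) zero    = begin
  convolve dyck (dyckFrom 1) m + dyck (suc m) * 1
    ≡⟨ cong₂ _+_ (convolve-dyckFrom m 1) (*-identityʳ (dyck (suc m))) ⟩
  dyckFrom 2 m + dyck (suc m)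
    ≡⟨ +-comm (dyckFrom 2 m) (dyck (suc m)) ⟩
  dyckFrom 1 (suc m) ∎
  where open ≡-Reasoning
convolve-dyckFrom (suc m) (suc h) = begin
  convolve dyck (λ k → dyckFrom h (suc k) + dyckFrom (suc (suc h)) k) m + dyck (suc m) * 1
    ≡⟨ cong (_+ dyck (suc m) * 1) (convolve-+ dyck (dyckFrom h ∘ suc) (dyckFrom (suc (suc h))) m) ⟩
  convolve dyck (dyckFrom h ∘ suc) m + convolve dyck (dyckFrom (suc (suc h))) m + dyck (suc m) * 1
    ≡⟨ xy∙z≈xz∙y (convolve dyck (dyckFrom h ∘ suc) m) _ (dyck (suc m) * 1) ⟩
  convolve dyck (dyckFrom h) (suc m) + convolve dyck (dyckFrom (suc (suc h))) m
    ≡⟨ cong₂ _+_ (convolve-dyckFrom (suc m) h) (convolve-dyckFrom m (suc (suc h))) ⟩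
  dyckFrom (suc h) (suc m) + dyckFrom (suc (suc (suc h))) m ∎
  where open ≡-Reasoning

dyck-suc : ∀ m → dyck (suc m) ≡ convolve dyck dyck m
dyck-suc m = sym (convolve-dyckFrom m 0)

pascal : ∀ n k → suc n C suc k ≡ n C k + n C suc k
pascal n k = sym (nCk+nC[k+1]≡[n+1]C[k+1] n k)

-- The reflection principle for the n = h + 2m + 2 step paths from height h to 0: reflecting the
-- part before the first visit to height -1 maps those with m + 1 up-steps that go below 0 onto
-- all those with m up-steps.
dyckFrom-reflection : ∀ h m →
  dyckFrom h (suc m) + suc (suc (h + (m + m))) C m ≡ suc (suc (h + (m + m))) C suc m
dyckFrom-reflection zero    zero    = refl
dyckFrom-reflection (suc h) zero    = begin
  dyckFrom h 1 + 1 + 1   ≡⟨ cong (_+ 1) (dyckFrom-reflection h zero) ⟩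
  X C 1 + 1              ≡⟨ cong (_+ 1) (nC1≡n X) ⟩
  X + 1                  ≡⟨ +-comm X 1 ⟩
  suc X                  ≡⟨ nC1≡n (suc X) ⟨
  suc X C 1              ∎
  where
  open ≡-Reasoning
  X = suc (suc (h + 0))
dyckFrom-reflection zero    (suc m) = begin
  dyckFrom 1 (suc m) + suc (suc (suc (m + suc m))) C suc m
    ≡⟨ cong (λ x → dyckFrom 1 (suc m) + suc x C suc m) X≡Y ⟩
  dyckFrom 1 (suc m) + suc Y C suc m
    ≡⟨ cong (dyckFrom 1 (suc m) +_) (pascal Y m) ⟩
  dyckFrom 1 (suc m) + (Y C m + Y C suc m)
    ≡⟨ +-assoc (dyckFrom 1 (suc m)) _ _ ⟨
  dyckFrom 1 (suc m) + Y C m + Y C suc m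
    ≡⟨ cong₂ _+_ (dyckFrom-reflection 1 m) (nCk≡nC[n∸k] m+1≤Y) ⟩
  Y C suc m + Y C (Y ∸ suc m)
    ≡⟨ cong (λ k → Y C suc m + Y C k) Y∸[m+1]≡m+2 ⟩
  Y C suc m + Y C suc (suc m)
    ≡⟨ pascal Y (suc m) ⟨
  suc Y C suc (suc m)
    ≡⟨ cong (λ x → suc x C suc (suc m)) X≡Y ⟨
  suc (suc (suc (m + suc m))) C suc (suc m) ∎
  where
  open ≡-Reasoning
  Y = suc (suc (suc (m + m)))
  X≡Y : suc (suc (m + suc m)) ≡ Y
  X≡Y = cong (suc ∘ suc) (+-suc m m)
  m+1≤Y : suc m ≤ Y
  m+1≤Y = s≤s (≤-trans (m≤m+n m m) (≤-trans (n≤1+n _) (n≤1+n _)))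
  Y∸[m+1]≡m+2 : Y ∸ suc m ≡ suc (suc m)
  Y∸[m+1]≡m+2 = trans (+-∸-assoc 2 (m≤m+n m m)) (cong (suc ∘ suc) (m+n∸m≡n m m))
dyckFrom-reflection (suc h) (suc m) = begin
  (A + B) + suc X C suc m
    ≡⟨ cong ((A + B) +_) (trans (pascal X m) (+-comm (X C m) (X C suc m))) ⟩
  (A + B) + (X C suc m + X C m)
    ≡⟨ interchange A B (X C suc m) (X C m) ⟩
  (A + X C suc m) + (B + X C m)
    ≡⟨ cong₂ _+_ (dyckFrom-reflection h (suc m)) IH₂ ⟩
  X C suc (suc m) + X C suc m
    ≡⟨ +-comm (X C suc (suc m)) (X C suc m) ⟩
  X C suc m + X C suc (suc m)
    ≡⟨ pascal X (suc m) ⟨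
  suc X C suc (suc m) ∎
  where
  open ≡-Reasoning
  A = dyckFrom h (suc (suc m))
  B = dyckFrom (suc (suc h)) (suc m)
  X = suc (suc (h + suc (m + suc m)))
  Z≡X : suc (suc (suc (suc (h + (m + m))))) ≡ X
  Z≡X = cong (suc ∘ suc) (sym (trans (cong (h +_) (cong suc (+-suc m m)))
                                     (trans (+-suc h _) (cong suc (+-suc h _)))))
  IH₂ : B + X C m ≡ X C suc m
  IH₂ = subst (λ x → B + x C m ≡ x C suc m) Z≡X (dyckFrom-reflection (suc (suc h)) m)

C-absorption : ∀ n k → suc k * (n C suc k) + k * (n C k) ≡ n * (n C k)
C-absorption zero    zero    = refl
C-absorption zero    (suc k) = cong₂ _+_ (*-zeroʳ (suc (suc k))) (*-zeroʳ (suc k))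
C-absorption (suc n) zero    = begin
  1 * (suc n C 1) + 0   ≡⟨ +-identityʳ _ ⟩
  1 * (suc n C 1)       ≡⟨ *-identityˡ _ ⟩
  suc n C 1             ≡⟨ nC1≡n (suc n) ⟩
  suc n                 ≡⟨ *-identityʳ (suc n) ⟨
  suc n * 1             ∎
  where open ≡-Reasoning
C-absorption (suc n) (suc k) = begin
  suc (suc k) * (suc n C suc (suc k)) + suc k * (suc n C suc k)
    ≡⟨ cong₂ (λ x y → suc (suc k) * x + suc k * y) (pascal n (suc k)) (pascal n k) ⟩
  suc (suc k) * (b + d) + suc k * (a + b)
    ≡⟨ regroup k a b d ⟩
  (a + b) + ((suc k * b + k * a) + (suc (suc k) * d + suc k * b))
    ≡⟨ cong ((a + b) +_) (cong₂ _+_ (C-absorption n k) (C-absorption n (suc k))) ⟩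
  (a + b) + (n * a + n * b)
    ≡⟨ cong ((a + b) +_) (*-distribˡ-+ n a b) ⟨
  suc n * (a + b)
    ≡⟨ cong (suc n *_) (pascal n k) ⟨
  suc n * (suc n C suc k) ∎
  where
  open ≡-Reasoning
  a = n C k
  b = n C suc k
  d = n C suc (suc k)
  regroup : ∀ k a b d → suc (suc k) * (b + d) + suc k * (a + b) ≡
                        (a + b) + ((suc k * b + k * a) + (suc (suc k) * d + suc k * b))
  regroup = solve-∀

[1+m]*dyck≡[m+m]Cm : ∀ m → suc m * dyck m ≡ (m + m) C m
[1+m]*dyck≡[m+m]Cm zero    = refl
[1+m]*dyck≡[m+m]Cm (suc m) = trans (cancel m (dyck (suc m)) (n C m) (n C suc m)
                                  (dyckFrom-reflection 0 m) (C-absorption n m))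
                           (cong (λ x → x C suc m) (cong suc (sym (+-suc m m))))
  where
  n = suc (suc (m + m))
  cancel : ∀ k c B₀ B₁ → c + B₀ ≡ B₁ → suc k * B₁ + k * B₀ ≡ suc (suc (k + k)) * B₀ →
           suc (suc k) * c ≡ B₁
  cancel k c B₀ B₁ c+B₀≡B₁ absorb = begin
    suc (suc k) * c   ≡⟨⟩
    c + suc k * c     ≡⟨ cong (c +_) (+-cancelʳ-≡ (suc (k + k) * B₀) _ _ k+1*c≡B₀) ⟩
    c + B₀            ≡⟨ c+B₀≡B₁ ⟩
    B₁                ∎
    where
    open ≡-Reasoning
    expand : ∀ k c B₀ → suc k * (c + B₀) + k * B₀ ≡ suc k * c + suc (k + k) * B₀
    expand = solve-∀
    k+1*c≡B₀ : suc k * c + suc (k + k) * B₀ ≡ B₀ + suc (k + k) * B₀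
    k+1*c≡B₀ = trans (sym (expand k c B₀))
                     (trans (cong (λ x → suc k * x + k * B₀) c+B₀≡B₁) absorb)

dyck≡catalan : ∀ m → dyck m ≡ catalan m
dyck≡catalan m = sym (begin
  ((m + m) C m) / suc m      ≡⟨ cong (_/ suc m) ([1+m]*dyck≡[m+m]Cm m) ⟨
  (suc m * dyck m) / suc m   ≡⟨ cong (_/ suc m) (*-comm (suc m) (dyck m)) ⟩
  (dyck m * suc m) / suc m   ≡⟨ m*n/n≡m (dyck m) (suc m) ⟩
  dyck m                     ∎)
  where open ≡-Reasoning

Enumerates : {I A : Set} → (I → A) → (A → Set) → Set
Enumerates {A = A} e P = Injective _≡_ _≡_ e × (∀ i → P (e i)) × ((a : A) → P a → ∃ λ i → e i ≡ a)

Enumerates-reindex : {I J A : Set} {P : A → Set} {e : I → A} (σ : J ↔ I) → Enumerates e P →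
                     Enumerates (e ∘ Inverse.to σ) P
Enumerates-reindex {e = e} σ (injective , sound , complete) =
  (λ eq → trans (sym (strictlyInverseʳ _)) (trans (cong from (injective eq)) (strictlyInverseʳ _))) ,
  sound ∘ to ,
  λ a pa → let i , eᵢ≡a = complete a pa in from i , trans (cong e (strictlyInverseˡ i)) eᵢ≡a
  where open Inverse σ

Enumerates-⊎ : {I J A : Set} {P Q : A → Set} {e₁ : I → A} {e₂ : J → A} → Enumerates e₁ P → Enumerates e₂ Q →
               (∀ {a} → P a → Q a → ⊥) → Enumerates [ e₁ , e₂ ]′ (λ a → P a ⊎ Q a)
Enumerates-⊎ {P = P} {Q} {e₁} {e₂} (injective₁ , sound₁ , complete₁) (injective₂ , sound₂ , complete₂)
             disjoint =
  injective , sound , complete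
  where
  injective : Injective _≡_ _≡_ [ e₁ , e₂ ]′
  injective {inj₁ i} {inj₁ j} eq = cong inj₁ (injective₁ eq)
  injective {inj₁ i} {inj₂ j} eq = ⊥-elim (disjoint (subst P eq (sound₁ i)) (sound₂ j))
  injective {inj₂ i} {inj₁ j} eq = ⊥-elim (disjoint (sound₁ j) (subst Q eq (sound₂ i)))
  injective {inj₂ i} {inj₂ j} eq = cong inj₂ (injective₂ eq)
  sound : ∀ i → P ([ e₁ , e₂ ]′ i) ⊎ Q ([ e₁ , e₂ ]′ i)
  sound (inj₁ i) = inj₁ (sound₁ i)
  sound (inj₂ j) = inj₂ (sound₂ j)
  complete : ∀ a → P a ⊎ Q a → ∃ λ i → [ e₁ , e₂ ]′ i ≡ a
  complete a (inj₁ pa) = let i , eq = complete₁ a pa in inj₁ i , eq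
  complete a (inj₂ qa) = let j , eq = complete₂ a qa in inj₂ j , eq

Enumerates-× : {I J A B : Set} {P : A → Set} {Q : B → Set} {e₁ : I → A} {e₂ : J → B} →
               Enumerates e₁ P → Enumerates e₂ Q →
               Enumerates (×-map e₁ e₂) (λ ab → P (proj₁ ab) × Q (proj₂ ab))
Enumerates-× (injective₁ , sound₁ , complete₁) (injective₂ , sound₂ , complete₂) =
  (λ eq → cong₂ _,_ (injective₁ (cong proj₁ eq)) (injective₂ (cong proj₂ eq))) ,
  (λ ij → sound₁ (proj₁ ij) , sound₂ (proj₂ ij)) ,
  λ ab pq → let i , eq₁ = complete₁ (proj₁ ab) (proj₁ pq) ; j , eq₂ = complete₂ (proj₂ ab) (proj₂ pq)
            in (i , j) , cong₂ _,_ eq₁ eq₂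

module _ {A : Set} {P Q : A → Set} where

  HasCount-⊎ : ∀ {a b} → HasCount P a → HasCount Q b → (∀ {x} → P x → Q x → ⊥) →
               HasCount (λ x → P x ⊎ Q x) (a + b)
  HasCount-⊎ {a} {b} (_ , enum₁) (_ , enum₂) disjoint =
    _ , Enumerates-reindex (+↔⊎ {a} {b}) (Enumerates-⊎ enum₁ enum₂ disjoint)

  HasCount-resp : ∀ {k} → (∀ {x} → P x → Q x) → (∀ {x} → Q x → P x) → HasCount P k → HasCount Q k
  HasCount-resp P⇒Q Q⇒P (e , injective , sound , complete) =
    e , injective , P⇒Q ∘ sound , λ a → complete a ∘ Q⇒P

HasCount-× : {A B : Set} {P : A → Set} {Q : B → Set} {a b : ℕ} → HasCount P a → HasCount Q b →
             HasCount (λ xy → P (proj₁ xy) × Q (proj₂ xy)) (a * b)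
HasCount-× {a = a} {b} (_ , enum₁) (_ , enum₂) =
  _ , Enumerates-reindex (*↔× {a} {b}) (Enumerates-× enum₁ enum₂)

module _ {A B : Set} {P : A → Set} {Q : B → Set} {k : ℕ} where

  HasCount-image : (f : A → B) → Injective _≡_ _≡_ f → (∀ {a} → P a → Q (f a)) →
                   (∀ {b} → Q b → ∃ λ a → P a × f a ≡ b) → HasCount P k → HasCount Q k
  HasCount-image f f-injective P⇒Q Q⇒P (e , injective , sound , complete) =
    f ∘ e , injective ∘ f-injective , P⇒Q ∘ sound ,
    λ b qb → let a , pa , fa≡b = Q⇒P qb ; i , eᵢ≡a = complete a pa in i , trans (cong f eᵢ≡a) fa≡b

  HasCount-preimage : (g : B → A) → Injective _≡_ _≡_ g → (∀ {b} → Q b → P (g b)) →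
                      (∀ {b} → P (g b) → Q b) → (∀ {a} → P a → ∃ λ b → g b ≡ a) →
                      HasCount P k → HasCount Q k
  HasCount-preimage g g-injective Q⇒P P⇒Q lift (e , injective , sound , complete) =
    e′ , (λ eq → injective (trans (sym (g∘e′≡e _)) (trans (cong g eq) (g∘e′≡e _)))) ,
    (λ i → P⇒Q (subst P (sym (g∘e′≡e i)) (sound i))) ,
    λ b qb → let i , eᵢ≡gb = complete (g b) (Q⇒P qb) in i , g-injective (trans (g∘e′≡e i) eᵢ≡gb)
    where
    e′ : Fin k → B
    e′ i = proj₁ (lift (sound i))
    g∘e′≡e : ∀ i → g (e′ i) ≡ e i
    g∘e′≡e i = proj₂ (lift (sound i))

Convolution : {A B : Set} → (ℕ → A → Set) → (ℕ → B → Set) → ℕ → A × B → Set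
Convolution P Q m xy = ∃₂ λ i j → i + j ≡ m × P i (proj₁ xy) × Q j (proj₂ xy)

HasCount-convolve : {A B : Set} {P : ℕ → A → Set} {Q : ℕ → B → Set} {f g : ℕ → ℕ} (m : ℕ) →
                    (∀ {i i′ x} → P i x → P i′ x → i ≡ i′) →
                    (∀ i → i ≤ m → HasCount (P i) (f i)) → (∀ j → j ≤ m → HasCount (Q j) (g j)) →
                    HasCount (Convolution P Q m) (convolve f g m)
HasCount-convolve zero P-graded countP countQ =
  HasCount-resp (λ (px , qy) → 0 , 0 , refl , px , qy) (λ { (0 , 0 , refl , px , qy) → px , qy })
                (HasCount-× (countP 0 z≤n) (countQ 0 z≤n))
HasCount-convolve {P = P} {Q} (suc m) P-graded countP countQ =
  HasCount-resp to from (HasCount-⊎ (HasCount-convolve m P-graded (λ i i≤m → countP i (m≤n⇒m≤1+n i≤m))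
                                                                  (λ j j≤m → countQ (suc j) (s≤s j≤m)))
                                    (HasCount-× (countP (suc m) ≤-refl) (countQ 0 z≤n))
                                    disjoint)
  where
  disjoint : ∀ {xy} → Convolution P (Q ∘ suc) m xy → P (suc m) (proj₁ xy) × Q 0 (proj₂ xy) → ⊥
  disjoint (i , j , i+j≡m , px , _) (px′ , _) =
    <-irrefl refl (≤-trans (m≤m+n (suc m) j) (≤-reflexive (trans (cong (_+ j) (P-graded px′ px)) i+j≡m)))
  to : ∀ {xy} → Convolution P (Q ∘ suc) m xy ⊎ (P (suc m) (proj₁ xy) × Q 0 (proj₂ xy)) →
       Convolution P Q (suc m) xy
  to (inj₁ (i , j , i+j≡m , px , qy)) = i , suc j , trans (+-suc i j) (cong suc i+j≡m) , px , qy
  to (inj₂ (px , qy))                 = suc m , 0 , +-identityʳ (suc m) , px , qy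
  from : ∀ {xy} → Convolution P Q (suc m) xy →
         Convolution P (Q ∘ suc) m xy ⊎ (P (suc m) (proj₁ xy) × Q 0 (proj₂ xy))
  from (i , zero , i+0≡m+1 , px , qy) =
    inj₂ (subst (λ n → P n _) (trans (sym (+-identityʳ i)) i+0≡m+1) px , qy)
  from (i , suc j , eq , px , qy)    = inj₁ (i , j , suc-injective (trans (sym (+-suc i j)) eq) , px , qy)

data Tree : Set where
  leaf : Tree
  node : Tree → Tree → Tree

size : Tree → ℕ
size leaf       = 0
size (node l r) = suc (size l + size r)

Sized : ℕ → Tree → Set
Sized m t = size t ≡ m

trees-count : ∀ m → HasCount (Sized m) (dyck m)
trees-count = <-rec (λ m → HasCount (Sized m) (dyck m)) count
  where
  leaves : HasCount (Sized 0) 1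
  leaves = (λ _ → leaf) , (λ { {Fin.zero} {Fin.zero} _ → refl }) , (λ _ → refl) ,
           λ { leaf _ → Fin.zero , refl ; (node _ _) () }
  count : ∀ m → (∀ {i} → i < m → HasCount (Sized i) (dyck i)) → HasCount (Sized m) (dyck m)
  count zero    _   = leaves
  count (suc m) rec =
    subst (HasCount _) (sym (dyck-suc m))
      (HasCount-image (uncurry node) (λ { {_ , _} {_ , _} refl → refl }) sound complete
        (HasCount-convolve m (λ p q → trans (sym p) q) (λ i i≤m → rec (s≤s i≤m)) (λ j j≤m → rec (s≤s j≤m))))
    where
    sound : ∀ {lr} → Convolution Sized Sized m lr → Sized (suc m) (uncurry node lr)
    sound (i , j , i+j≡m , refl , refl) = cong suc i+j≡m
    complete : ∀ {t} → Sized (suc m) t → ∃ λ lr → Convolution Sized Sized m lr × uncurry node lr ≡ t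
    complete {node l r} eq = (l , r) , (size l , size r , suc-injective eq , refl , refl) , refl

m+m≡m*2 : ∀ m → m + m ≡ m * 2
m+m≡m*2 m = trans (cong (m +_) (sym (+-identityʳ m))) (*-comm 2 m)

even-double : ∀ m → Even (m + m)
even-double m = divides m (m+m≡m*2 m)

even⇒odd-suc : ∀ {n} → Even n → Odd (suc n)
even⇒odd-suc {n} 2∣n 2∣1+n with ∣1⇒≡1 (∣m+n∣m⇒∣n (subst (2 ∣_) (+-comm 1 n) 2∣1+n) 2∣n)
... | ()

even-suc⇒odd : ∀ {n} → Even (suc n) → Odd n
even-suc⇒odd 2∣1+n 2∣n = even⇒odd-suc 2∣n 2∣1+n

even-or-odd : ∀ n → ∃ λ m → n ≡ m + m ⊎ n ≡ suc (m + m)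
even-or-odd zero = 0 , inj₁ refl
even-or-odd (suc n) with even-or-odd n
... | m , inj₁ n≡2m   = m , inj₂ (cong suc n≡2m)
... | m , inj₂ n≡2m+1 = suc m , inj₁ (cong suc (trans n≡2m+1 (sym (+-suc m m))))

odd-suc⇒even : ∀ {n} → Odd (suc n) → Even n
odd-suc⇒even {n} odd with even-or-odd n
... | m , inj₁ refl = even-double m
... | m , inj₂ refl = ⊥-elim (odd (subst Even (cong suc (+-suc m m)) (even-double (suc m))))

length-++-∷ : ∀ {A : Set} (xs : List A) y ys → length (xs ++ y ∷ ys) ≡ suc (length xs + length ys)
length-++-∷ xs y ys = trans (length-++-sucʳ xs y ys) (cong suc (length-++ xs))

++-∷≢[] : ∀ {A : Set} (xs : List A) {y ys} → xs ++ y ∷ ys ≢ []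
++-∷≢[] []      ()
++-∷≢[] (_ ∷ _) ()

++-∷-cancel : ∀ {A : Set} {x : A} xs xs′ {ys ys′} → x ∉ xs → x ∉ xs′ →
              xs ++ x ∷ ys ≡ xs′ ++ x ∷ ys′ → xs ≡ xs′ × ys ≡ ys′
++-∷-cancel []       []         _   _    refl = refl , refl
++-∷-cancel []       (_ ∷ _)    _   x∉xs′ eq  = ⊥-elim (x∉xs′ (here (∷-injectiveˡ eq)))
++-∷-cancel (_ ∷ _)  []         x∉xs _    eq  = ⊥-elim (x∉xs (here (sym (∷-injectiveˡ eq))))
++-∷-cancel (y ∷ xs) (_ ∷ xs′)  x∉xs x∉xs′ eq with ∷-injective eq
... | refl , eq′ = ×-map (cong (y ∷_)) id (++-∷-cancel xs xs′ (x∉xs ∘ there) (x∉xs′ ∘ there) eq′)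

unique-++⁻ : ∀ {A : Set} (xs : List A) {ys} → Unique (xs ++ ys) → Unique xs × Unique ys × Disjoint xs ys
unique-++⁻ []       unique         = [] , unique , λ ()
unique-++⁻ (x ∷ xs) (x∉ ∷ unique) =
  let uxs , uys , disjoint = unique-++⁻ xs unique ; x∉xs , x∉ys = All-++⁻ xs x∉ in
  x∉xs ∷ uxs , uys , λ { (here refl , v∈ys)  → All.lookup x∉ys v∈ys refl
                       ; (there v∈xs , v∈ys) → disjoint (v∈xs , v∈ys) }

Bounded : ℕ → List ℕ → Set
Bounded n w = ∀ {x} → x ∈ w → 0 < x × x ≤ n

module _ {A : Set} where

  unique-⊆⇒length≤ : ∀ {xs ys : List A} → Unique xs → xs ⊆ ys → length xs ≤ length ys
  unique-⊆⇒length≤ {[]}     _               _     = z≤n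
  unique-⊆⇒length≤ {x ∷ xs} (x∉xs ∷ unique) xs⊆ys with ∈-∃++ (xs⊆ys (here refl))
  ... | ys₁ , ys₂ , refl = subst (suc (length xs) ≤_) (sym (length-++-sucʳ ys₁ x ys₂))
                                 (s≤s (unique-⊆⇒length≤ unique remove-x))
    where
    remove-x : xs ⊆ ys₁ ++ ys₂
    remove-x y∈xs with ∈-++⁻ ys₁ (xs⊆ys (there y∈xs))
    ... | inj₁ y∈ys₁         = ∈-++⁺ˡ y∈ys₁
    ... | inj₂ (here refl)   = ⊥-elim (All.lookup x∉xs y∈xs refl)
    ... | inj₂ (there y∈ys₂) = ∈-++⁺ʳ ys₁ y∈ys₂

∈-1…n : ∀ {n x} → 0 < x → x ≤ n → x ∈ applyUpTo suc n
∈-1…n {x = suc x} _ x<n = ∈-applyUpTo⁺ suc x<n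

∈-1…n⁻ : ∀ {n x} → x ∈ applyUpTo suc n → 0 < x × x ≤ n
∈-1…n⁻ x∈ with ∈-applyUpTo⁻ suc x∈
... | _ , i<n , refl = s≤s z≤n , i<n

unique-1…n : ∀ n → Unique (applyUpTo suc n)
unique-1…n n = Unique.applyUpTo⁺₁ suc n (λ i<j _ i+1≡j+1 → <-irrefl (suc-injective i+1≡j+1) i<j)

-- Pigeonhole: otherwise x ∷ w would be n + 1 distinct letters in 1..n.
bounded-unique⇒∈ : ∀ {n w x} → length w ≡ n → Unique w → Bounded n w → 0 < x → x ≤ n → x ∈ w
bounded-unique⇒∈ {n} {w} {x} refl unique bounded 0<x x≤n with x ∈? w
... | yes x∈w = x∈w
... | no  x∉w = ⊥-elim (<-irrefl refl (≤-trans (unique-⊆⇒length≤ (¬Any⇒All¬ w x∉w ∷ unique) into-1…n)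
                                                (≤-reflexive (length-applyUpTo suc n))))
  where
  into-1…n : x ∷ w ⊆ applyUpTo suc n
  into-1…n (here refl)  = ∈-1…n 0<x x≤n
  into-1…n (there y∈w)  = uncurry ∈-1…n (bounded y∈w)

DumontStep : ℕ → ℕ → Set
DumontStep x y = (Even x → y < x) × (Odd x → x < y)

DumontWord : List ℕ → Set
DumontWord []          = ⊤
DumontWord (x ∷ [])    = Odd x
DumontWord (x ∷ y ∷ w) = DumontStep x y × DumontWord (y ∷ w)

dumont-++-∷ : ∀ A {N B} → DumontWord A → (∀ {x} → x ∈ A → x < N) → DumontWord (N ∷ B) →
              DumontWord (A ++ N ∷ B)
dumont-++-∷ []          _           _     dNB = dNB
dumont-++-∷ (x ∷ [])    odd         A<N   dNB = ((λ even → ⊥-elim (odd even)) , λ _ → A<N (here refl)) , dNB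
dumont-++-∷ (x ∷ y ∷ A) (step , dA) A<N   dNB = step , dumont-++-∷ (y ∷ A) dA (λ x∈ → A<N (there x∈)) dNB

dumont-++-∷⁻ : ∀ A {N B} → DumontWord (A ++ N ∷ B) → (∀ {x} → x ∈ A → x < N) →
               DumontWord A × DumontWord (N ∷ B)
dumont-++-∷⁻ []          dNB                   _   = tt , dNB
dumont-++-∷⁻ (x ∷ [])    ((descent , _) , dNB) A<N =
  (λ even → <-asym (descent even) (A<N (here refl))) , dNB
dumont-++-∷⁻ (x ∷ y ∷ A) (step , d)            A<N =
  let dA , dNB = dumont-++-∷⁻ (y ∷ A) d (λ x∈ → A<N (there x∈)) in (step , dA) , dNB

dumont-tail : ∀ {x} w → DumontWord (x ∷ w) → DumontWord w
dumont-tail []      _       = tt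
dumont-tail (_ ∷ _) (_ , d) = d

dumont-∷-even : ∀ {N B} → Even N → B ≢ [] → (∀ {z} → z ∈ B → z < N) → DumontWord B → DumontWord (N ∷ B)
dumont-∷-even {B = []}    _    B≢[] _   _ = ⊥-elim (B≢[] refl)
dumont-∷-even {B = _ ∷ _} even _    B<N d = ((λ _ → B<N (here refl)) , λ odd → ⊥-elim (odd even)) , d

dumont-∷-odd⇒[] : ∀ {N B} → DumontWord (N ∷ B) → (∀ {z} → z ∈ B → z < N) → Odd N → B ≡ []
dumont-∷-odd⇒[] {B = []}    _                  _   _   = refl
dumont-∷-odd⇒[] {B = _ ∷ _} ((_ , ascent) , _) B<N odd = ⊥-elim (<-asym (ascent odd) (B<N (here refl)))

dumont-∷-even⇒≢[] : ∀ {N B} → DumontWord (N ∷ B) → Even N → B ≢ []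
dumont-∷-even⇒≢[] odd even refl = odd even

module _ {b : ℕ} (even-b : Even b) where

  even-+ : ∀ {x} → Even x → Even (b + x)
  even-+ = ∣m∣n⇒∣m+n even-b

  even-+⁻ : ∀ {x} → Even (b + x) → Even x
  even-+⁻ even = ∣m+n∣m⇒∣n even even-b

  dumont-shift : ∀ w → DumontWord w → DumontWord (map (b +_) w)
  dumont-shift []          _                        = tt
  dumont-shift (x ∷ [])    odd                      = odd ∘ even-+⁻
  dumont-shift (x ∷ y ∷ w) ((descent , ascent) , d) =
    ((λ even → +-monoʳ-< b (descent (even-+⁻ even))) ,
     (λ odd → +-monoʳ-< b (ascent (odd ∘ even-+)))) ,
    dumont-shift (y ∷ w) d

  dumont-unshift : ∀ w → DumontWord (map (b +_) w) → DumontWord w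
  dumont-unshift []          _                        = tt
  dumont-unshift (x ∷ [])    odd                      = odd ∘ even-+
  dumont-unshift (x ∷ y ∷ w) ((descent , ascent) , d) =
    ((λ even → +-cancelˡ-< b _ _ (descent (even-+ even))) ,
     (λ odd → +-cancelˡ-< b _ _ (ascent (odd ∘ even-+⁻)))) ,
    dumont-unshift (y ∷ w) d

-- The smallest letter of a Dumont word cannot be followed by a smaller one.
dumont-min-odd : ∀ {w x} → DumontWord w → x ∈ w → (∀ {y} → y ∈ w → x ≤ y) → Odd x
dumont-min-odd {_ ∷ []}    odd                 (here refl) _   = odd
dumont-min-odd {_ ∷ _ ∷ _} ((descent , _) , _) (here refl) min =
  λ even → <⇒≱ (descent even) (min (there (here refl)))
dumont-min-odd {_ ∷ _ ∷ _} (_ , d)             (there x∈)  min = dumont-min-odd d x∈ (λ y∈ → min (there y∈))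

Avoids132Word : List ℕ → Set
Avoids132Word w = ∀ {x y z} → x ∷ y ∷ z ∷ [] ⊑ w → ¬ (x < z × z < y)

⊑-++⁻ : {A : Set} (xs : List A) {ys zs : List A} → zs ⊑ xs ++ ys →
        ∃₂ λ zs₁ zs₂ → zs₁ ⊑ xs × zs₂ ⊑ ys × zs₁ ++ zs₂ ≡ zs
⊑-++⁻ []       p          = [] , _ , minimum [] , p , refl
⊑-++⁻ (x ∷ xs) (_ ∷ʳ p)   = let zs₁ , zs₂ , p₁ , p₂ , eq = ⊑-++⁻ xs p in zs₁ , zs₂ , x ∷ʳ p₁ , p₂ , eq
⊑-++⁻ (x ∷ xs) (refl ∷ p) = let zs₁ , zs₂ , p₁ , p₂ , eq = ⊑-++⁻ xs p in
                            x ∷ zs₁ , zs₂ , refl ∷ p₁ , p₂ , cong (x ∷_) eq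

⊑-map⁻ : {A B : Set} (f : A → B) (xs : List A) {ys : List B} → ys ⊑ map f xs →
         ∃ λ zs → zs ⊑ xs × map f zs ≡ ys
⊑-map⁻ f []       []         = [] , [] , refl
⊑-map⁻ f (x ∷ xs) (_ ∷ʳ p)   = let zs , p′ , eq = ⊑-map⁻ f xs p in zs , x ∷ʳ p′ , eq
⊑-map⁻ f (x ∷ xs) (refl ∷ p) = let zs , p′ , eq = ⊑-map⁻ f xs p in x ∷ zs , refl ∷ p′ , cong (f x ∷_) eq

avoids-shift : ∀ b w → Avoids132Word w → Avoids132Word (map (b +_) w)
avoids-shift b w avoids p with ⊑-map⁻ (b +_) w p
... | _ ∷ _ ∷ _ ∷ [] , p′ , refl = λ (x<z , z<y) → avoids p′ (+-cancelˡ-< b _ _ x<z , +-cancelˡ-< b _ _ z<y)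

avoids-unshift : ∀ b w → Avoids132Word (map (b +_) w) → Avoids132Word w
avoids-unshift b w avoids p (x<z , z<y) = avoids (⊑-map⁺ (b +_) p) (+-monoʳ-< b x<z , +-monoʳ-< b z<y)

∷-⊑⇒∈tail : ∀ {y z N : ℕ} {B} → y ∷ z ∷ [] ⊑ N ∷ B → z ∈ B
∷-⊑⇒∈tail (_ ∷ʳ q)   = to∈ (∷ˡ⁻ q)
∷-⊑⇒∈tail (refl ∷ q) = to∈ q

module _ (A : List ℕ) {N : ℕ} {B : List ℕ} where

  avoids-++-∷ : Avoids132Word A → Avoids132Word B → (∀ {x z} → x ∈ A → z ∈ B → z < x) →
                (∀ {x} → x ∈ A → x < N) → (∀ {z} → z ∈ B → z < N) → Avoids132Word (A ++ N ∷ B)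
  avoids-++-∷ avoidsA avoidsB B<A A<N B<N p with ⊑-++⁻ A p
  ... | []                , _ , _  , _ ∷ʳ q   , refl = avoidsB q
  ... | []                , _ , _  , refl ∷ q , refl = λ (x<z , z<y) → <-asym (<-trans x<z z<y)
                                                                              (B<N (to∈ q))
  ... | _ ∷ []            , _ , p₁ , q        , refl = λ (x<z , _) → <-asym x<z (B<A (to∈ p₁) (∷-⊑⇒∈tail q))
  ... | _ ∷ _ ∷ _ ∷ []    , _ , p₁ , _        , refl = avoidsA p₁
  ... | _ ∷ _ ∷ _ ∷ _ ∷ _ , _ , _  , _        , ()
  ... | _ ∷ _ ∷ []        , _ , p₁ , q        , refl with to∈ q
  ...   | here refl = λ (_ , z<y) → <-asym z<y (A<N (to∈ (∷ˡ⁻ p₁)))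
  ...   | there z∈B = λ (x<z , _) → <-asym x<z (B<A (to∈ p₁) z∈B)

  avoids-++-∷⇒separated : Avoids132Word (A ++ N ∷ B) → ∀ {x z} → x ∈ A → z ∈ B → z < N → ¬ x < z
  avoids-++-∷⇒separated avoids x∈A z∈B z<N x<z = avoids (++⁺ (from∈ x∈A) (refl ∷ from∈ z∈B)) (x<z , z<N)

-- Decomposition at the maximum

record Dumont132Word (w : List ℕ) : Set where
  field
    unique  : Unique w
    bounded : Bounded (length w) w
    dumont  : DumontWord w
    avoids  : Avoids132Word w

[]-dumont132 : Dumont132Word []
[]-dumont132 = record { unique = [] ; bounded = λ () ; dumont = tt ; avoids = λ () }

_⊕_ : List ℕ → List ℕ → List ℕ
A ⊕ B = map (length B +_) A ++ suc (length A + length B) ∷ B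

length-⊕ : ∀ A B → length (A ⊕ B) ≡ suc (length A + length B)
length-⊕ A B = trans (length-++-∷ (map _ A) _ B) (cong (λ a → suc (a + length B)) (length-map _ A))

⊕≢[] : ∀ A B → A ⊕ B ≢ []
⊕≢[] A B = ++-∷≢[] (map (length B +_) A)

shift-bounds : ∀ {a b A x} → Bounded a A → x ∈ map (b +_) A → b < x × x ≤ a + b
shift-bounds {a} {b} bounded x∈ with ∈-map⁻ (b +_) x∈
... | y , y∈A , refl = let 0<y , y≤a = bounded y∈A in
  subst (_< b + y) (+-identityʳ b) (+-monoʳ-< b 0<y) , subst (b + y ≤_) (+-comm b a) (+-monoʳ-≤ b y≤a)

⊕-injective : ∀ {A A′ B B′} → Bounded (length A) A → Bounded (length A′) A′ →
              A ⊕ B ≡ A′ ⊕ B′ → A ≡ A′ × B ≡ B′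
⊕-injective {A} {A′} {B} {B′} boundedA boundedA′ eq = A≡A′ , B≡B′
  where
  N≡N′ : suc (length A + length B) ≡ suc (length A′ + length B′)
  N≡N′ = trans (sym (length-⊕ A B)) (trans (cong length eq) (length-⊕ A′ B′))
  split : map (length B +_) A ≡ map (length B′ +_) A′ × B ≡ B′
  split = ++-∷-cancel (map (length B +_) A) (map (length B′ +_) A′)
            (λ N′∈ → <-irrefl (sym N≡N′) (s≤s (proj₂ (shift-bounds boundedA N′∈))))
            (λ N′∈ → <-irrefl refl (s≤s (proj₂ (shift-bounds boundedA′ N′∈))))
            (trans (cong (λ N → map (length B +_) A ++ N ∷ B) (sym N≡N′)) eq)
  B≡B′ = proj₂ split
  A≡A′ = map-injective (+-cancelˡ-≡ (length B′) _ _)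
           (trans (cong (λ B → map (length B +_) A) (sym B≡B′)) (proj₁ split))

-- Shifting A by length B preserves the parities of its letters only if length B is even.
⊕-dumont132 : ∀ {A B} → Dumont132Word A → Dumont132Word B → A ≡ [] ⊎ Even (length B) →
              DumontWord (suc (length A + length B) ∷ B) → Dumont132Word (A ⊕ B)
⊕-dumont132 {A} {B} goodA goodB shiftable top = record
  { unique  = Unique.++⁺ (Unique.map⁺ (+-cancelˡ-≡ b _ _) (unique goodA))
                         (All.tabulate (λ z∈B N≡z → <-irrefl (sym N≡z) (B<N z∈B)) ∷ unique goodB)
                         disjoint
  ; bounded = subst (λ n → Bounded n (A ⊕ B)) (sym (length-⊕ A B)) bounded-by-N
  ; dumont  = dumont-++-∷ A′ (dumont-A′ shiftable) A′<N top
  ; avoids  = avoids-++-∷ A′ (avoids-shift b A (avoids goodA)) (avoids goodB) B<A′ A′<N B<N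
  }
  where
  open Dumont132Word
  a = length A
  b = length B
  N = suc (a + b)
  A′ = map (b +_) A
  A′-bounds : ∀ {x} → x ∈ A′ → b < x × x ≤ a + b
  A′-bounds = shift-bounds (bounded goodA)
  A′<N : ∀ {x} → x ∈ A′ → x < N
  A′<N x∈A′ = s≤s (proj₂ (A′-bounds x∈A′))
  B<N : ∀ {z} → z ∈ B → z < N
  B<N z∈B = s≤s (≤-trans (proj₂ (bounded goodB z∈B)) (m≤n+m b a))
  B<A′ : ∀ {x z} → x ∈ A′ → z ∈ B → z < x
  B<A′ x∈A′ z∈B = ≤-<-trans (proj₂ (bounded goodB z∈B)) (proj₁ (A′-bounds x∈A′))
  disjoint : Disjoint A′ (N ∷ B)
  disjoint (x∈A′ , here refl)  = <-irrefl refl (A′<N x∈A′)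
  disjoint (x∈A′ , there x∈B) = <-irrefl refl (B<A′ x∈A′ x∈B)
  bounded-by-N : Bounded N (A′ ++ N ∷ B)
  bounded-by-N x∈ with ∈-++⁻ A′ x∈
  ... | inj₁ x∈A′        = ≤-trans (s≤s z≤n) (proj₁ (A′-bounds x∈A′)) , <⇒≤ (A′<N x∈A′)
  ... | inj₂ (here refl)  = s≤s z≤n , ≤-refl
  ... | inj₂ (there x∈B) = proj₁ (bounded goodB x∈B) , <⇒≤ (B<N x∈B)
  dumont-A′ : A ≡ [] ⊎ Even b → DumontWord A′
  dumont-A′ (inj₁ refl)   = tt
  dumont-A′ (inj₂ even-b) = dumont-shift even-b A (dumont goodA)

record Decomposition (w : List ℕ) : Set where
  field
    left right      : List ℕ
    left⊕right≡w    : left ⊕ right ≡ w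
    left-dumont132  : Dumont132Word left
    right-dumont132 : Dumont132Word right
    shiftable       : left ≡ [] ⊎ Even (length right)
    odd⇒right≡[]    : Odd (length w) → right ≡ []
    even⇒right≢[]   : Even (length w) → right ≢ []

max-split : ∀ {x w} → Dumont132Word (x ∷ w) → ∃₂ λ α β → x ∷ w ≡ α ++ suc (length α + length β) ∷ β
max-split {w = w} good =
  let α , β , eq = ∈-∃++ (bounded-unique⇒∈ refl unique bounded (s≤s z≤n) (≤-refl {suc (length w)}))
  in α , β , trans eq (cong (λ N → α ++ N ∷ β) (trans (cong length eq) (length-++-∷ α _ β)))
  where open Dumont132Word good

module Decompose {α β : List ℕ} (good : Dumont132Word (α ++ suc (length α + length β) ∷ β)) where

  open Dumont132Word good

  private
    a = length α
    b = length β
    N = suc (a + b)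

  length≡N : length (α ++ N ∷ β) ≡ N
  length≡N = length-++-∷ α N β

  bounded-by-N : Bounded N (α ++ N ∷ β)
  bounded-by-N = subst (λ n → Bounded n (α ++ N ∷ β)) length≡N bounded

  private
    unique-parts : Unique α × Unique (N ∷ β) × Disjoint α (N ∷ β)
    unique-parts = unique-++⁻ α unique

  α∩Nβ : Disjoint α (N ∷ β)
  α∩Nβ = proj₂ (proj₂ unique-parts)

  α<N : ∀ {x} → x ∈ α → x < N
  α<N x∈α = ≤∧≢⇒< (proj₂ (bounded-by-N (∈-++⁺ˡ x∈α))) (λ { refl → α∩Nβ (x∈α , here refl) })

  β<N : ∀ {z} → z ∈ β → z < N
  β<N z∈β = ≤∧≢⇒< (proj₂ (bounded-by-N (∈-++⁺ʳ α (there z∈β))))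
                  (λ { refl → All.lookup (AllPairs.head (proj₁ (proj₂ unique-parts))) z∈β refl })

  private
    dumont-parts : DumontWord α × DumontWord (N ∷ β)
    dumont-parts = dumont-++-∷⁻ α dumont α<N

  β<α : ∀ {x z} → x ∈ α → z ∈ β → z < x
  β<α x∈α z∈β = ≤∧≢⇒< (≮⇒≥ (avoids-++-∷⇒separated α avoids x∈α z∈β (β<N z∈β)))
                      (λ { refl → α∩Nβ (x∈α , there z∈β) })

  -- Every y ≤ z occurs in the whole word, but neither in α (which lies above z) nor as N.
  β≤b : ∀ {z} → z ∈ β → z ≤ b
  β≤b {z} z∈β = subst (_≤ b) (length-applyUpTo suc z) (unique-⊆⇒length≤ (unique-1…n z) 1…z⊆β)
    where
    1…z⊆β : applyUpTo suc z ⊆ β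
    1…z⊆β y∈ with 0<y , y≤z ← ∈-1…n⁻ y∈
                 with ∈-++⁻ α (bounded-unique⇒∈ length≡N unique bounded-by-N 0<y
                                                (≤-trans y≤z (<⇒≤ (β<N z∈β))))
    ... | inj₁ y∈α         = ⊥-elim (<⇒≱ (β<α y∈α z∈β) y≤z)
    ... | inj₂ (here refl)  = ⊥-elim (<⇒≱ (β<N z∈β) y≤z)
    ... | inj₂ (there y∈β) = y∈β

  β-unique : Unique β
  β-unique = AllPairs.tail (proj₁ (proj₂ unique-parts))

  β-bounded : Bounded b β
  β-bounded z∈β = proj₁ (bounded-by-N (∈-++⁺ʳ α (there z∈β))) , β≤b z∈β

  β-dumont132 : Dumont132Word β
  β-dumont132 = record
    { unique  = β-unique
    ; bounded = β-bounded
    ; dumont  = dumont-tail β (proj₂ dumont-parts)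
    ; avoids  = λ p → avoids (++⁺ˡ α (N ∷ʳ p))
    }

  α-bounds : ∀ {x} → x ∈ α → b < x × x ≤ a + b
  α-bounds x∈α = ≰⇒> (λ x≤b → α∩Nβ (x∈α , there (bounded-unique⇒∈ refl β-unique β-bounded 0<x x≤b))) ,
                 ≤-pred (α<N x∈α)
    where 0<x = proj₁ (bounded-by-N (∈-++⁺ˡ x∈α))

  A : List ℕ
  A = map (_∸ b) α

  shift-A : map (b +_) A ≡ α
  shift-A = trans (sym (map-∘ α))
                  (map-id-local (All.tabulate (λ x∈α → m+[n∸m]≡n (<⇒≤ (proj₁ (α-bounds x∈α))))))

  A-unique : Unique A
  A-unique = Unique.map⁻ (subst Unique (sym shift-A) (proj₁ unique-parts))

  A-bounded : Bounded (length A) A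
  A-bounded y∈A with ∈-map⁻ (_∸ b) y∈A
  ... | x , x∈α , refl = m<n⇒0<n∸m b<x ,
                         ≤-trans (∸-monoˡ-≤ b x≤a+b)
                                 (≤-reflexive (trans (m+n∸n≡m a b) (sym (length-map _ α))))
    where
    b<x = proj₁ (α-bounds x∈α)
    x≤a+b = proj₂ (α-bounds x∈α)

  -- b + 1 is the least letter of α, and the least letter of a Dumont word is odd.
  nonempty⇒even-b : 0 < length A → Even b
  nonempty⇒even-b 0<|A| =
    odd-suc⇒even (subst Odd (+-comm b 1) (dumont-min-odd (proj₁ dumont-parts) b+1∈α b+1≤))
    where
    b+1∈α : b + 1 ∈ α
    b+1∈α = subst (b + 1 ∈_) shift-A
                  (∈-map⁺ (b +_) (bounded-unique⇒∈ refl A-unique A-bounded (s≤s z≤n) 0<|A|))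
    b+1≤ : ∀ {y} → y ∈ α → b + 1 ≤ y
    b+1≤ {y} y∈α = subst (_≤ y) (+-comm 1 b) (proj₁ (α-bounds y∈α))

  shiftable : A ≡ [] ⊎ Even b
  shiftable with A in eq
  ... | []    = inj₁ refl
  ... | _ ∷ _ = inj₂ (nonempty⇒even-b (subst (λ xs → 0 < length xs) (sym eq) (s≤s z≤n)))

  A-dumont132 : Dumont132Word A
  A-dumont132 = record
    { unique  = A-unique
    ; bounded = A-bounded
    ; dumont  = A-dumont shiftable
    ; avoids  = avoids-unshift b A (subst Avoids132Word (sym shift-A) (avoids ∘ ++⁺ʳ (N ∷ β)))
    }
    where
    A-dumont : A ≡ [] ⊎ Even b → DumontWord A
    A-dumont (inj₁ A≡[]) = subst DumontWord (sym A≡[]) tt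
    A-dumont (inj₂ even-b) = dumont-unshift even-b A (subst DumontWord (sym shift-A) (proj₁ dumont-parts))

  decomposition : Decomposition (α ++ N ∷ β)
  decomposition = record
    { left            = A
    ; right           = β
    ; left⊕right≡w    = cong₂ (λ xs a → xs ++ suc (a + b) ∷ β) shift-A (length-map _ α)
    ; left-dumont132  = A-dumont132
    ; right-dumont132 = β-dumont132
    ; shiftable       = shiftable
    ; odd⇒right≡[]    = dumont-∷-odd⇒[] (proj₂ dumont-parts) β<N ∘ subst Odd length≡N
    ; even⇒right≢[]   = dumont-∷-even⇒≢[] (proj₂ dumont-parts) ∘ subst Even length≡N
    }

decompose : ∀ {x w} → Dumont132Word (x ∷ w) → Decomposition (x ∷ w)
decompose good with α , β , eq ← max-split good =
  subst Decomposition (sym eq) (Decompose.decomposition (subst Dumont132Word eq good))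

-- Encoding by binary trees

mutual
  evenWord : Tree → List ℕ
  evenWord leaf                  = []
  evenWord (node l leaf)         = [] ⊕ oddWord l
  evenWord (node l r@(node _ _)) = oddWord l ⊕ evenWord r

  oddWord : Tree → List ℕ
  oddWord t = evenWord t ⊕ []

evenWord-node≢[] : ∀ l r → evenWord (node l r) ≢ []
evenWord-node≢[] l leaf         = ⊕≢[] [] (oddWord l)
evenWord-node≢[] l (node r₁ r₂) = ⊕≢[] (oddWord l) (evenWord (node r₁ r₂))

length-evenWord-node : ∀ l r → length (evenWord (node l r)) ≡ suc (length (oddWord l) + length (evenWord r))
length-evenWord-node l leaf         = cong suc (sym (+-identityʳ _))
length-evenWord-node l (node r₁ r₂) = length-⊕ (oddWord l) (evenWord (node r₁ r₂))

mutual
  length-evenWord : ∀ t → length (evenWord t) ≡ size t + size t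
  length-evenWord leaf       = refl
  length-evenWord (node l r) = begin
    length (evenWord (node l r))
      ≡⟨ length-evenWord-node l r ⟩
    suc (length (oddWord l) + length (evenWord r))
      ≡⟨ cong₂ (λ x y → suc (x + y)) (length-oddWord l) (length-evenWord r) ⟩
    suc (suc (size l + size l) + (size r + size r))
      ≡⟨ regroup (size l) (size r) ⟩
    size (node l r) + size (node l r) ∎
    where
    open ≡-Reasoning
    regroup : ∀ l r → suc (suc (l + l) + (r + r)) ≡ suc (l + r) + suc (l + r)
    regroup = solve-∀

  length-oddWord : ∀ t → length (oddWord t) ≡ suc (size t + size t)
  length-oddWord t = trans (length-⊕ (evenWord t) []) (cong suc (trans (+-identityʳ _) (length-evenWord t)))

⊕-top-even : ∀ {A B : List ℕ} → Dumont132Word B → B ≢ [] → Even (suc (length A + length B)) →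
             DumontWord (suc (length A + length B) ∷ B)
⊕-top-even {A} goodB B≢[] even =
  dumont-∷-even even B≢[] (λ z∈B → s≤s (≤-trans (proj₂ (bounded z∈B)) (m≤n+m _ (length A)))) dumont
  where open Dumont132Word goodB

mutual
  evenWord-dumont132 : ∀ t → Dumont132Word (evenWord t)
  evenWord-dumont132 leaf                  = []-dumont132
  evenWord-dumont132 (node l leaf)         =
    ⊕-dumont132 []-dumont132 (oddWord-dumont132 l) (inj₁ refl)
      (⊕-top-even {[]} (oddWord-dumont132 l) (⊕≢[] (evenWord l) [])
        (subst (Even ∘ suc) (sym (length-oddWord l)) (∣m∣n⇒∣m+n ∣-refl (even-double (size l)))))
  evenWord-dumont132 (node l r@(node r₁ r₂)) =
    ⊕-dumont132 (oddWord-dumont132 l) (evenWord-dumont132 r)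
      (inj₂ (subst Even (sym (length-evenWord r)) (even-double (size r))))
      (⊕-top-even {oddWord l} (evenWord-dumont132 r) (evenWord-node≢[] r₁ r₂)
        (subst (Even ∘ suc) (sym (cong₂ _+_ (length-oddWord l) (length-evenWord r)))
               (∣m∣n⇒∣m+n ∣-refl (∣m∣n⇒∣m+n (even-double (size l)) (even-double (size r))))))

  oddWord-dumont132 : ∀ t → Dumont132Word (oddWord t)
  oddWord-dumont132 t =
    ⊕-dumont132 (evenWord-dumont132 t) []-dumont132 (inj₂ (divides 0 refl))
      (even⇒odd-suc (subst Even (sym (trans (+-identityʳ _) (length-evenWord t))) (even-double (size t))))

mutual
  evenWord-injective : ∀ t t′ → evenWord t ≡ evenWord t′ → t ≡ t′
  evenWord-injective leaf       leaf          _  = refl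
  evenWord-injective leaf       (node l′ r′)  eq = ⊥-elim (evenWord-node≢[] l′ r′ (sym eq))
  evenWord-injective (node l r) leaf          eq = ⊥-elim (evenWord-node≢[] l r eq)
  evenWord-injective (node l leaf) (node l′ leaf) eq =
    cong (λ l → node l leaf) (oddWord-injective l l′ (proj₂ (⊕-injective {[]} {[]} (λ ()) (λ ()) eq)))
  evenWord-injective (node l leaf) (node l′ (node _ _)) eq =
    ⊥-elim (⊕≢[] (evenWord l′) []
                 (sym (proj₁ (⊕-injective {[]} (λ ()) (bounded (oddWord-dumont132 l′)) eq))))
    where open Dumont132Word
  evenWord-injective (node l (node _ _)) (node l′ leaf) eq =
    ⊥-elim (⊕≢[] (evenWord l) [] (proj₁ (⊕-injective {A′ = []} (bounded (oddWord-dumont132 l)) (λ ()) eq)))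
    where open Dumont132Word
  evenWord-injective (node l r@(node _ _)) (node l′ r′@(node _ _)) eq =
    let l≡l′ , r≡r′ = ⊕-injective (bounded (oddWord-dumont132 l)) (bounded (oddWord-dumont132 l′)) eq
    in cong₂ node (oddWord-injective l l′ l≡l′) (evenWord-injective r r′ r≡r′)
    where open Dumont132Word

  oddWord-injective : ∀ t t′ → oddWord t ≡ oddWord t′ → t ≡ t′
  oddWord-injective t t′ eq =
    evenWord-injective t t′
      (proj₁ (⊕-injective (bounded (evenWord-dumont132 t)) (bounded (evenWord-dumont132 t′)) eq))
    where open Dumont132Word

Encoded : List ℕ → Set
Encoded w = (Even (length w) → ∃ λ t → evenWord t ≡ w) × (Odd (length w) → ∃ λ t → oddWord t ≡ w)

module _ {w : List ℕ} (D : Decomposition w) where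

  open Decomposition D

  length-decomposition : length w ≡ suc (length left + length right)
  length-decomposition = trans (cong length (sym left⊕right≡w)) (length-⊕ left right)

  decomposition⇒encoded : Encoded left → Encoded right → Encoded w
  decomposition⇒encoded (encode-even-left , encode-odd-left) (encode-even-right , encode-odd-right) =
    even-case , odd-case
    where
    even-case : Even (length w) → ∃ λ t → evenWord t ≡ w
    even-case even with shiftable | even-suc⇒odd (subst Even length-decomposition even)
    ... | inj₁ left≡[] | odd-sum =
      let l , eq = encode-odd-right (subst (λ a → Odd (a + length right)) (cong length left≡[]) odd-sum)
      in node l leaf , trans (cong₂ _⊕_ (sym left≡[]) eq) left⊕right≡w
    ... | inj₂ even-right | odd-sum with encode-even-right even-right
    ...   | leaf , eq = ⊥-elim (even⇒right≢[] even (sym eq))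
    ...   | node r₁ r₂ , eq =
      let l , eqˡ = encode-odd-left (λ even-left → odd-sum (∣m∣n⇒∣m+n even-left even-right))
      in node l (node r₁ r₂) , trans (cong₂ _⊕_ eqˡ eq) left⊕right≡w
    odd-case : Odd (length w) → ∃ λ t → oddWord t ≡ w
    odd-case odd =
      let right≡[] = odd⇒right≡[] odd
          even-sum = odd-suc⇒even (subst Odd length-decomposition odd)
          t , eq = encode-even-left (subst Even (trans (cong (length left +_) (cong length right≡[]))
                                                       (+-identityʳ _)) even-sum)
      in t , trans (cong₂ _⊕_ eq (sym right≡[])) left⊕right≡w

dumont132⇒encoded : ∀ w → Dumont132Word w → Encoded w
dumont132⇒encoded w = <-rec (λ n → ∀ w → length w ≡ n → Dumont132Word w → Encoded w) step (length w) w refl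
  where
  step : ∀ n → (∀ {m} → m < n → ∀ w → length w ≡ m → Dumont132Word w → Encoded w) →
         ∀ w → length w ≡ n → Dumont132Word w → Encoded w
  step _ _   []      _    _    = (λ _ → leaf , refl) , λ odd → ⊥-elim (odd (divides 0 refl))
  step _ rec (_ ∷ w) refl good =
    decomposition⇒encoded D (rec shorter-left left refl left-dumont132)
                            (rec shorter-right right refl right-dumont132)
    where
    D = decompose good
    open Decomposition D
    shorter-left : length left < suc (length w)
    shorter-left = ≤-trans (s≤s (m≤m+n _ _)) (≤-reflexive (sym (length-decomposition D)))
    shorter-right : length right < suc (length w)
    shorter-right = ≤-trans (s≤s (m≤n+m _ _)) (≤-reflexive (sym (length-decomposition D)))

double-injective : ∀ {m n} → m + m ≡ n + n → m ≡ n
double-injective {m} {n} eq = trans (n≡⌊n+n/2⌋ m) (trans (cong ⌊_/2⌋ eq) (sym (n≡⌊n+n/2⌋ n)))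

even-words-count : ∀ m → HasCount (λ w → length w ≡ m + m × Dumont132Word w) (dyck m)
even-words-count m = HasCount-image evenWord (evenWord-injective _ _) sound complete (trees-count m)
  where
  sound : ∀ {t} → Sized m t → length (evenWord t) ≡ m + m × Dumont132Word (evenWord t)
  sound {t} refl = length-evenWord t , evenWord-dumont132 t
  complete : ∀ {w} → length w ≡ m + m × Dumont132Word w → ∃ λ t → Sized m t × evenWord t ≡ w
  complete {w} (|w|≡2m , good) =
    let t , eq = proj₁ (dumont132⇒encoded w good) (subst Even (sym |w|≡2m) (even-double m))
        lengths = trans (sym (length-evenWord t)) (trans (cong length eq) |w|≡2m)
    in t , double-injective lengths , eq

odd-words-count : ∀ m → HasCount (λ w → length w ≡ suc (m + m) × Dumont132Word w) (dyck m)
odd-words-count m = HasCount-image oddWord (oddWord-injective _ _) sound complete (trees-count m)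
  where
  sound : ∀ {t} → Sized m t → length (oddWord t) ≡ suc (m + m) × Dumont132Word (oddWord t)
  sound {t} refl = length-oddWord t , oddWord-dumont132 t
  complete : ∀ {w} → length w ≡ suc (m + m) × Dumont132Word w → ∃ λ t → Sized m t × oddWord t ≡ w
  complete {w} (|w|≡2m+1 , good) =
    let t , eq = proj₂ (dumont132⇒encoded w good) (subst Odd (sym |w|≡2m+1) (even⇒odd-suc (even-double m)))
        lengths = trans (sym (length-oddWord t)) (trans (cong length eq) |w|≡2m+1)
    in t , double-injective (suc-injective lengths) , eq

-- IsDumont and Avoids132 are stated for val v, i.e. for functions on Fin n; induction needs Fin k.
DumontAt : ∀ {k} → (Fin k → ℕ) → Set
DumontAt {k} g = ((i : Fin k) → Even (g i) → ∃ λ (j : Fin k) → (toℕ j ≡ suc (toℕ i)) × (g j < g i))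
               × ((i j : Fin k) → Odd (g i) → toℕ j ≡ suc (toℕ i) → g i < g j)

AvoidsAt : ∀ {k} → (Fin k → ℕ) → Set
AvoidsAt {k} g = (i j l : Fin k) → i Fin.< j → j Fin.< l → ¬ ((g i < g l) × (g l < g j))

module _ {k : ℕ} {g : Fin (suc (suc k)) → ℕ} where

  DumontAt-head : DumontAt g → DumontStep (g Fin.zero) (g (Fin.suc Fin.zero))
  DumontAt-head (descent , ascent) = descent′ , λ odd → ascent Fin.zero (Fin.suc Fin.zero) odd refl
    where
    descent′ : Even (g Fin.zero) → g (Fin.suc Fin.zero) < g Fin.zero
    descent′ even with descent Fin.zero even
    ... | Fin.suc Fin.zero , _ , lt = lt

  DumontAt-tail : DumontAt g → DumontAt (g ∘ Fin.suc)
  DumontAt-tail (descent , ascent) =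
    descent′ , λ i j odd eq → ascent (Fin.suc i) (Fin.suc j) odd (cong suc eq)
    where
    descent′ : ∀ i → Even (g (Fin.suc i)) → ∃ λ j → toℕ j ≡ suc (toℕ i) × g (Fin.suc j) < g (Fin.suc i)
    descent′ i even with descent (Fin.suc i) even
    ... | Fin.suc j , eq , lt = j , suc-injective eq , lt

  DumontAt-∷ : DumontStep (g Fin.zero) (g (Fin.suc Fin.zero)) → DumontAt (g ∘ Fin.suc) → DumontAt g
  DumontAt-∷ (descent , ascent) (descent′ , ascent′) = descent″ , ascent″
    where
    descent″ : ∀ i → Even (g i) → ∃ λ j → toℕ j ≡ suc (toℕ i) × g j < g i
    descent″ Fin.zero    even = Fin.suc Fin.zero , refl , descent even
    descent″ (Fin.suc i) even = let j , eq , lt = descent′ i even in Fin.suc j , cong suc eq , lt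
    ascent″ : ∀ i j → Odd (g i) → toℕ j ≡ suc (toℕ i) → g i < g j
    ascent″ Fin.zero    (Fin.suc Fin.zero) odd refl = ascent odd
    ascent″ (Fin.suc i) (Fin.suc j)        odd eq   = ascent′ i j odd (suc-injective eq)

dumontAt⇒word : ∀ {k} (g : Fin k → ℕ) → DumontAt g → DumontWord (tabulate g)
dumontAt⇒word {zero}        g _                 = tt
dumontAt⇒word {suc zero}    g (descent , _) even with descent Fin.zero even
... | Fin.zero , () , _
dumontAt⇒word {suc (suc k)} g d = DumontAt-head d , dumontAt⇒word (g ∘ Fin.suc) (DumontAt-tail d)

word⇒dumontAt : ∀ {k} (g : Fin k → ℕ) → DumontWord (tabulate g) → DumontAt g
word⇒dumontAt {zero}        g _          = (λ ()) , λ ()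
word⇒dumontAt {suc zero}    g odd        =
  (λ { Fin.zero even → ⊥-elim (odd even) }) , λ { Fin.zero Fin.zero _ () }
word⇒dumontAt {suc (suc k)} g (step , d) = DumontAt-∷ step (word⇒dumontAt (g ∘ Fin.suc) d)

⊑-tabulate-pair⁻ : ∀ {k} (g : Fin k → ℕ) {y z} → y ∷ z ∷ [] ⊑ tabulate g →
                   ∃₂ λ j l → j Fin.< l × g j ≡ y × g l ≡ z
⊑-tabulate-pair⁻ {suc k} g (_ ∷ʳ p) =
  let j , l , j<l , eqs = ⊑-tabulate-pair⁻ (g ∘ Fin.suc) p in Fin.suc j , Fin.suc l , s≤s j<l , eqs
⊑-tabulate-pair⁻ {suc k} g (refl ∷ p) =
  let l , eq = ∈-tabulate⁻ (to∈ p) in Fin.zero , Fin.suc l , s≤s z≤n , refl , sym eq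

⊑-tabulate-triple⁻ : ∀ {k} (g : Fin k → ℕ) {x y z} → x ∷ y ∷ z ∷ [] ⊑ tabulate g →
                     ∃₂ λ i j → ∃ λ l → i Fin.< j × j Fin.< l × g i ≡ x × g j ≡ y × g l ≡ z
⊑-tabulate-triple⁻ {suc k} g (_ ∷ʳ p) =
  let i , j , l , i<j , j<l , eqs = ⊑-tabulate-triple⁻ (g ∘ Fin.suc) p
  in Fin.suc i , Fin.suc j , Fin.suc l , s≤s i<j , s≤s j<l , eqs
⊑-tabulate-triple⁻ {suc k} g (refl ∷ p) =
  let j , l , j<l , eqs = ⊑-tabulate-pair⁻ (g ∘ Fin.suc) p
  in Fin.zero , Fin.suc j , Fin.suc l , s≤s z≤n , s≤s j<l , refl , eqs

⊑-tabulate-pair⁺ : ∀ {k} (g : Fin k → ℕ) {j l} → j Fin.< l → g j ∷ g l ∷ [] ⊑ tabulate g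
⊑-tabulate-pair⁺ g {Fin.zero}  {Fin.suc l} _         = refl ∷ from∈ (∈-tabulate⁺ l)
⊑-tabulate-pair⁺ g {Fin.suc j} {Fin.suc l} (s≤s j<l) = g Fin.zero ∷ʳ ⊑-tabulate-pair⁺ (g ∘ Fin.suc) j<l

⊑-tabulate-triple⁺ : ∀ {k} (g : Fin k → ℕ) {i j l} → i Fin.< j → j Fin.< l →
                     g i ∷ g j ∷ g l ∷ [] ⊑ tabulate g
⊑-tabulate-triple⁺ g {Fin.zero}  {Fin.suc j} {Fin.suc l} _         (s≤s j<l) =
  refl ∷ ⊑-tabulate-pair⁺ (g ∘ Fin.suc) j<l
⊑-tabulate-triple⁺ g {Fin.suc i} {Fin.suc j} {Fin.suc l} (s≤s i<j) (s≤s j<l) =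
  g Fin.zero ∷ʳ ⊑-tabulate-triple⁺ (g ∘ Fin.suc) i<j j<l

avoidsAt⇒word : ∀ {k} (g : Fin k → ℕ) → AvoidsAt g → Avoids132Word (tabulate g)
avoidsAt⇒word g avoids p with ⊑-tabulate-triple⁻ g p
... | i , j , l , i<j , j<l , refl , refl , refl = avoids i j l i<j j<l

word⇒avoidsAt : ∀ {k} (g : Fin k → ℕ) → Avoids132Word (tabulate g) → AvoidsAt g
word⇒avoidsAt g avoids i j l i<j j<l = avoids (⊑-tabulate-triple⁺ g i<j j<l)

unique-tabulate⇒injective : ∀ {k} (g : Fin k → ℕ) → Unique (tabulate g) → Injective _≡_ _≡_ g
unique-tabulate⇒injective {suc k} g _              {Fin.zero}  {Fin.zero}  _  = refl
unique-tabulate⇒injective {suc k} g (g₀∉ ∷ _)      {Fin.zero}  {Fin.suc j} eq =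
  ⊥-elim (All.lookup g₀∉ (∈-tabulate⁺ j) eq)
unique-tabulate⇒injective {suc k} g (g₀∉ ∷ _)      {Fin.suc i} {Fin.zero}  eq =
  ⊥-elim (All.lookup g₀∉ (∈-tabulate⁺ i) (sym eq))
unique-tabulate⇒injective {suc k} g (_ ∷ unique)   {Fin.suc i} {Fin.suc j} eq =
  cong Fin.suc (unique-tabulate⇒injective (g ∘ Fin.suc) unique eq)

entries : ∀ {n k} → Vec (Fin n) k → List ℕ
entries v = tabulate (λ i → suc (toℕ (Vec.lookup v i)))

entries-injective : ∀ {n k} → Injective _≡_ _≡_ (entries {n} {k})
entries-injective {k = zero}  {Vec.[]}    {Vec.[]}      _  = refl
entries-injective {k = suc k} {x Vec.∷ v} {x′ Vec.∷ v′} eq =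
  let head≡ , tail≡ = ∷-injective eq
  in cong₂ Vec._∷_ (toℕ-injective (suc-injective head≡)) (entries-injective tail≡)

entries-surjective : ∀ {n k} w → length w ≡ k → Bounded n w → ∃ λ (v : Vec (Fin n) k) → entries v ≡ w
entries-surjective []      refl _       = Vec.[] , refl
entries-surjective (x ∷ w) refl bounded with bounded (here refl)
... | s≤s _ , x≤n =
  let v , eq = entries-surjective w refl (bounded ∘ there)
  in fromℕ< x≤n Vec.∷ v , cong₂ _∷_ (cong suc (toℕ-fromℕ< x≤n)) eq

module _ {n : ℕ} (v : Vec (Fin n) n) where

  isDumontAvoid132⇒word : IsDumontAvoid132 n v → Dumont132Word (entries v)
  isDumontAvoid132⇒word (perm , dumont , avoids) = record
    { unique  = Unique.tabulate⁺ (perm ∘ toℕ-injective ∘ suc-injective)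
    ; bounded = bounded
    ; dumont  = dumontAt⇒word (val v) dumont
    ; avoids  = avoidsAt⇒word (val v) avoids
    }
    where
    bounded : Bounded (length (entries v)) (entries v)
    bounded x∈ with i , refl ← ∈-tabulate⁻ x∈ =
      s≤s z≤n , subst (suc (toℕ (Vec.lookup v i)) ≤_) (sym (length-tabulate _)) (toℕ<n (Vec.lookup v i))

  word⇒isDumontAvoid132 : Dumont132Word (entries v) → IsDumontAvoid132 n v
  word⇒isDumontAvoid132 good =
    (λ eq → unique-tabulate⇒injective (val v) unique (cong (suc ∘ toℕ) eq)) ,
    word⇒dumontAt (val v) dumont , word⇒avoidsAt (val v) avoids
    where open Dumont132Word good

perms-count : ∀ {n c} → HasCount (λ w → length w ≡ n × Dumont132Word w) c → HasCount (IsDumontAvoid132 n) c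
perms-count = HasCount-preimage entries entries-injective
  (λ {v} p → length-tabulate _ , isDumontAvoid132⇒word v p)
  (λ {v} (_ , good) → word⇒isDumontAvoid132 v good)
  (λ { {w} (|w|≡n , good) →
        entries-surjective w |w|≡n (subst (λ k → Bounded k w) |w|≡n (Dumont132Word.bounded good)) })

[m+m]/2≡m : ∀ m → (m + m) / 2 ≡ m
[m+m]/2≡m m = trans (cong (_/ 2) (m+m≡m*2 m)) (m*n/n≡m m 2)

[1+m+m]/2≡m : ∀ m → suc (m + m) / 2 ≡ m
[1+m+m]/2≡m m = trans (+-distrib-/-∣ʳ 1 (even-double m)) ([m+m]/2≡m m)

theorem2p2 : (n : ℕ) → HasCount (IsDumontAvoid132 n) (catalan (n / 2))
theorem2p2 n with even-or-odd n
... | m , inj₁ refl = subst (HasCount _) (trans (dyck≡catalan m) (cong catalan (sym ([m+m]/2≡m m))))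
                            (perms-count (even-words-count m))
... | m , inj₂ refl = subst (HasCount _) (trans (dyck≡catalan m) (cong catalan (sym ([1+m+m]/2≡m m))))
                            (perms-count (odd-words-count m))
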